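{- For every integer $n\ge 7$, the complement $\overline{C_n}$ of the cycle $C_n$ is not a willow.
   Context: For a positive integer $m$, a graph $G$ is an $m$-willow if there exists an oriented tree $T$ with $V(G)\subseteq V(T)$ such that for all distinct $u,v\in V(G)$, $u$ and $v$ are adjacent in $G$ if and only if $T$ has a directed path from $u$ to $v$ or from $v$ to $u$ whose length is not a multiple of $m$. A willow is a graph that is an $m$-willow for some positive integer $m$. -}

module Defs where

open import Level using (0ℓ)
open import Data.Nat using (ℕ; zero; suc; _≤_; _∸_)
open import Data.Nat.Divisibility using (_∣_)
open import Data.Fin using (Fin; toℕ; fromℕ<; inject₁; fromℕ) renaming (zero to fzero; suc to fsuc)
open import Data.Product using (Σ; _×_; ∃; ∃-syntax)
open import Data.Sum using (_⊎_)
open import Relation.Nullary using (¬_)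
open import Relation.Binary.PropositionalEquality using (_≡_)
open import Function.Definitions using (Injective)

Rel : ℕ → Set₁
Rel k = Fin k → Fin k → Set

CycleAdj : (n : ℕ) → Rel n
CycleAdj n u v =
    (toℕ v ≡ suc (toℕ u)) ⊎ (toℕ u ≡ suc (toℕ v))
  ⊎ ((toℕ u ≡ 0 × toℕ v ≡ n ∸ 1) ⊎ (toℕ v ≡ 0 × toℕ u ≡ n ∸ 1))

ComplCycleAdj : (n : ℕ) → Rel n
ComplCycleAdj n u v = ¬ (u ≡ v) × ¬ CycleAdj n u v

Und : ∀ {k} → Rel k → Rel k
Und A u v = A u v ⊎ A v u

-- successor index modulo l along a cycle Fin (suc l) (wrapping last to 0)
nextFin : ∀ {l} → Fin (suc l) → Fin (suc l)
nextFin {zero} _ = fzero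
nextFin {suc l} fzero = fsuc fzero
nextFin {suc l} (fsuc i) with nextFin {l} i
... | fzero = fzero
... | fsuc j = fsuc (fsuc j)

WalkU : ∀ {k} → Rel k → Fin k → Fin k → ℕ → Set
WalkU {k} E u v L = Σ (Fin (suc L) → Fin k) λ w →
  (w fzero ≡ u) × (w (fromℕ L) ≡ v) ×
  ((i : Fin L) → E (w (inject₁ i)) (w (fsuc i)))

Connected : ∀ {k} → Rel k → Set
Connected {k} E = (u v : Fin k) → ∃[ L ] WalkU E u v L

-- a cycle: l+1 ≥ 3 distinct vertices c 0, ..., c l, cyclically consecutive ones adjacent
HasCycle : ∀ {k} → Rel k → Set
HasCycle {k} E = Σ ℕ λ l → (2 ≤ l) × Σ (Fin (suc l) → Fin k) λ c →
  Injective _≡_ _≡_ c × ((i : Fin (suc l)) → E (c i) (c (nextFin i)))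

IsTree : ∀ {k} → Rel k → Set
IsTree E = Connected E × ¬ HasCycle E

IsOrientedTree : ∀ {k} → Rel k → Set
IsOrientedTree {k} A =
  ((u : Fin k) → ¬ A u u) × ((u v : Fin k) → A u v → ¬ A v u) × IsTree (Und A)

DirPath : ∀ {k} → Rel k → Fin k → Fin k → ℕ → Set
DirPath {k} A u v L = Σ (Fin (suc L) → Fin k) λ w →
  Injective _≡_ _≡_ w ×
  (w fzero ≡ u) × (w (fromℕ L) ≡ v) ×
  ((i : Fin L) → A (w (inject₁ i)) (w (fsuc i)))

WillowRel : ∀ {k} → ℕ → Rel k → Fin k → Fin k → Set
WillowRel m A x y =
  (∃[ L ] (DirPath A x y L × ¬ (m ∣ L))) ⊎ (∃[ L ] (DirPath A y x L × ¬ (m ∣ L)))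

-- m-willows and willows.  V(G) ⊆ V(T) is modelled by an injection
-- f : Fin n → Fin k of the vertices of G into those of T.

IsMWillow : (n : ℕ) → Rel n → ℕ → Set₁
IsMWillow n G m = Σ ℕ λ k → Σ (Rel k) λ A → Σ (Fin n → Fin k) λ f →
  IsOrientedTree A × Injective _≡_ _≡_ f ×
  ((u v : Fin n) → ¬ (u ≡ v) →
     (G u v → WillowRel m A (f u) (f v)) × (WillowRel m A (f u) (f v) → G u v))

IsWillow : (n : ℕ) → Rel n → Set₁
IsWillow n G = Σ ℕ λ m → (1 ≤ m) × IsMWillow n G m

{-# OPTIONS --safe #-}
module Submission where

-- For an oriented tree T write x ≺ y when T has a nontrivial directed path from x to y.
-- This strict order is a "tree order": if w ≺ x, w ≺ y, x ≺ z and y ≺ z, then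
-- x and y are comparable, since w → x → z and w → y → z are the same path of
-- the tree.  In an m-willow adjacent vertices are comparable, and three
-- pairwise comparable vertices lie on one directed path, so their distances
-- add up; hence if xy and yz are non-edges (distances divisible by m) and x, y,
-- z are pairwise comparable, then xz is a non-edge as well.
--
-- In the complement of C_n all pairs at cyclic distance at least 2 are edges,
-- so comparable, while by the above no two consecutive cycle edges both join
-- comparable vertices.
-- The comparability graph of a tree order contains neither a gem (P₄ plus a
-- dominating vertex) nor an octahedron K₂,₂,₂, and for n ≥ 7 the pattern of
-- comparable cycle edges always produces one of these.

open import Defs
open import Data.Nat
  using (ℕ; zero; suc; pred; _+_; _∸_; _≤_; _<_; _<?_; z≤n; s≤s; NonZero; >-nonZero)
open import Data.Nat.Properties using (≤-refl; ≤-trans; ≤-reflexive; <-asym; <⇒≢; ≮⇒≥;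
  n≤1+n; n<1+n; n≤0⇒n≡0; m≤m+n; m≤n⇒m<n∨m≡n; m+n≤o⇒n≤o; m+n≤o⇒m≤o∸n; m<n+o⇒m∸n<o;
  +-comm; +-assoc; +-suc; +-identityʳ; +-cancelˡ-≡; +-cancelʳ-≤; +-monoˡ-≤; +-mono-<;
  ∸-monoˡ-≤; m+[n∸m]≡n; m∸n+n≡m; suc-injective; suc-pred)
open import Data.Nat.DivMod using (_%_; m%n<n; m%n%n≡m%n; %-distribˡ-+; [m+n]%n≡m%n;
  m<n⇒m%n≡m; m≤n⇒[n∸m]%m≡n%m)
open import Data.Nat.Divisibility using (_∣_; _∣?_; _∣0; ∣m∣n⇒∣m+n; ∣m+n∣m⇒∣n)
open import Data.Fin using (Fin; toℕ; fromℕ; fromℕ<; inject₁)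
  renaming (zero to fzero; suc to fsuc)
open import Data.Fin.Properties using (_≟_; toℕ-fromℕ<; toℕ-injective)
  renaming (suc-injective to fsuc-injective)
open import Data.List using (List; []; _∷_)
import Data.List as List
open import Data.List.Properties using (∷-injectiveˡ; ∷-injectiveʳ)
open import Data.List.Relation.Unary.Any using (here; there)
open import Data.List.Membership.Propositional using (_∈_; _∉_)
open import Data.Product using (Σ; ∃; ∃₂; _×_; _,_; proj₁; proj₂)
open import Data.Sum using (_⊎_; inj₁; inj₂; swap; [_,_]′)
open import Data.Empty using (⊥; ⊥-elim)
open import Data.Unit using (⊤; tt)
open import Function using (_∘_; id)
open import Function.Definitions using (Injective)
open import Relation.Binary.Definitions using (Sym)
open import Relation.Binary.Construct.Closure.ReflexiveTransitive
  using (Star; ε; _◅_; _◅◅_; map; revApp; reverse)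
open import Relation.Nullary using (¬_; yes; no)
open import Relation.Nullary.Decidable using (¬¬-excluded-middle; decidable-stable)
open import Relation.Binary.PropositionalEquality
  using (_≡_; _≢_; refl; sym; trans; cong; subst; subst₂; module ≡-Reasoning)

nextFin-cases : ∀ {l} (i : Fin (suc l)) →
  (i ≡ fromℕ l × nextFin i ≡ fzero) ⊎ (∃ λ j → i ≡ inject₁ j × nextFin i ≡ fsuc j)
nextFin-cases {zero} fzero = inj₁ (refl , refl)
nextFin-cases {suc l} fzero = inj₂ (fzero , refl , refl)
nextFin-cases {suc l} (fsuc i) with nextFin-cases {l} i
... | inj₁ (refl , next≡0) rewrite next≡0 = inj₁ (refl , refl)
... | inj₂ (j , refl , next≡) rewrite next≡ = inj₂ (fsuc j , refl , refl)

module _ {k : ℕ} {E : Rel k} where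

  vertices : ∀ {u v} → Star E u v → List (Fin k)
  vertices {u} ε = u ∷ []
  vertices {u} (_ ◅ p) = u ∷ vertices p

  length : ∀ {u v} → Star E u v → ℕ
  length ε = 0
  length (_ ◅ p) = suc (length p)

  Simple : ∀ {u v} → Star E u v → Set
  Simple ε = ⊤
  Simple {u} (_ ◅ p) = u ∉ vertices p × Simple p

  SimplePath : Fin k → Fin k → Set
  SimplePath u v = Σ (Star E u v) Simple

  head∈ : ∀ {u v} (p : Star E u v) → u ∈ vertices p
  head∈ ε = here refl
  head∈ (_ ◅ _) = here refl

  last∈ : ∀ {u v} (p : Star E u v) → v ∈ vertices p
  last∈ ε = here refl
  last∈ (_ ◅ p) = there (last∈ p)

  vertices-∷ : ∀ {u v} (p : Star E u v) → ∃ λ xs → vertices p ≡ u ∷ xs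
  vertices-∷ ε = [] , refl
  vertices-∷ (_ ◅ p) = vertices p , refl

  length-vertices : ∀ {u v} (p : Star E u v) → List.length (vertices p) ≡ suc (length p)
  length-vertices ε = refl
  length-vertices (_ ◅ p) = cong suc (length-vertices p)

  length-◅◅ : ∀ {u v w} (p : Star E u v) (q : Star E v w) →
              length (p ◅◅ q) ≡ length p + length q
  length-◅◅ ε q = refl
  length-◅◅ (_ ◅ p) q = cong suc (length-◅◅ p q)

  ∈-◅◅⁻ : ∀ {u v w x} (p : Star E u v) (q : Star E v w) →
          x ∈ vertices (p ◅◅ q) → x ∈ vertices p ⊎ x ∈ vertices q
  ∈-◅◅⁻ ε q x∈ = inj₂ x∈
  ∈-◅◅⁻ (_ ◅ p) q (here x≡u) = inj₁ (here x≡u)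
  ∈-◅◅⁻ (_ ◅ p) q (there x∈) = [ inj₁ ∘ there , inj₂ ]′ (∈-◅◅⁻ p q x∈)

  ∈-◅◅⁺ˡ : ∀ {u v w x} (p : Star E u v) (q : Star E v w) →
           x ∈ vertices p → x ∈ vertices (p ◅◅ q)
  ∈-◅◅⁺ˡ ε q (here refl) = head∈ q
  ∈-◅◅⁺ˡ (_ ◅ p) q (here x≡u) = here x≡u
  ∈-◅◅⁺ˡ (_ ◅ p) q (there x∈) = there (∈-◅◅⁺ˡ p q x∈)

  simple-◅◅ : ∀ {u v w} (p : Star E u v) (q : Star E v w) → Simple p → Simple q →
              (∀ {x} → x ∈ vertices p → x ∈ vertices q → x ≡ v) → Simple (p ◅◅ q)
  simple-◅◅ ε q _ sq _ = sq
  simple-◅◅ (_ ◅ p) q (u∉p , sp) sq common =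
    [ u∉p , (λ u∈q → u∉p (subst (_∈ vertices p) (sym (common (here refl) u∈q)) (last∈ p))) ]′
      ∘ ∈-◅◅⁻ p q
    , simple-◅◅ p q sp sq (common ∘ there)

  simple-◅◅⁻ : ∀ {u v w} (p : Star E u v) (q : Star E v w) →
               Simple (p ◅◅ q) → Simple p × Simple q
  simple-◅◅⁻ ε q sq = tt , sq
  simple-◅◅⁻ (_ ◅ p) q (u∉pq , spq) =
    (u∉pq ∘ ∈-◅◅⁺ˡ p q , proj₁ (simple-◅◅⁻ p q spq)) , proj₂ (simple-◅◅⁻ p q spq)

  split : ∀ {u v x} (p : Star E u v) → x ∈ vertices p →
          ∃₂ λ (p₁ : Star E u x) (p₂ : Star E x v) → p₁ ◅◅ p₂ ≡ p
  split ε (here refl) = ε , ε , refl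
  split (e ◅ p) (here refl) = ε , e ◅ p , refl
  split (e ◅ p) (there x∈) with split p x∈
  ... | p₁ , p₂ , refl = e ◅ p₁ , p₂ , refl

  simple-split : ∀ {u v x} (p : Star E u v) → Simple p → x ∈ vertices p →
                 SimplePath u x × SimplePath x v
  simple-split p sp x∈ with split p x∈
  ... | p₁ , p₂ , refl = (p₁ , proj₁ (simple-◅◅⁻ p₁ p₂ sp)) , (p₂ , proj₂ (simple-◅◅⁻ p₁ p₂ sp))

  simple-loop-length : ∀ {u v} (p : Star E u v) → Simple p → u ≡ v → length p ≡ 0
  simple-loop-length ε _ _ = refl
  simple-loop-length (_ ◅ p) (u∉p , _) refl = ⊥-elim (u∉p (last∈ p))

  positive-length : ∀ {u v} (p : Star E u v) → u ≢ v → 1 ≤ length p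
  positive-length ε u≢u = ⊥-elim (u≢u refl)
  positive-length (_ ◅ _) _ = s≤s z≤n

  vertexAt : ∀ {u v} (p : Star E u v) → Fin (suc (length p)) → Fin k
  vertexAt {u} ε _ = u
  vertexAt {u} (_ ◅ _) fzero = u
  vertexAt (_ ◅ p) (fsuc i) = vertexAt p i

  vertexAt-first : ∀ {u v} (p : Star E u v) → vertexAt p fzero ≡ u
  vertexAt-first ε = refl
  vertexAt-first (_ ◅ _) = refl

  vertexAt-last : ∀ {u v} (p : Star E u v) → vertexAt p (fromℕ (length p)) ≡ v
  vertexAt-last ε = refl
  vertexAt-last (_ ◅ p) = vertexAt-last p

  vertexAt-step : ∀ {u v} (p : Star E u v) (i : Fin (length p)) →
                  E (vertexAt p (inject₁ i)) (vertexAt p (fsuc i))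
  vertexAt-step (e ◅ p) fzero = subst (E _) (sym (vertexAt-first p)) e
  vertexAt-step (_ ◅ p) (fsuc i) = vertexAt-step p i

  vertexAt-∈ : ∀ {u v} (p : Star E u v) i → vertexAt p i ∈ vertices p
  vertexAt-∈ ε _ = here refl
  vertexAt-∈ (_ ◅ _) fzero = here refl
  vertexAt-∈ (_ ◅ p) (fsuc i) = there (vertexAt-∈ p i)

  vertexAt-injective : ∀ {u v} (p : Star E u v) → Simple p → Injective _≡_ _≡_ (vertexAt p)
  vertexAt-injective ε _ {fzero} {fzero} _ = refl
  vertexAt-injective (_ ◅ _) _ {fzero} {fzero} _ = refl
  vertexAt-injective (_ ◅ p) (u∉p , _) {fzero} {fsuc j} u≡ =
    ⊥-elim (u∉p (subst (_∈ vertices p) (sym u≡) (vertexAt-∈ p j)))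
  vertexAt-injective (_ ◅ p) (u∉p , _) {fsuc i} {fzero} ≡u =
    ⊥-elim (u∉p (subst (_∈ vertices p) ≡u (vertexAt-∈ p i)))
  vertexAt-injective (_ ◅ p) (_ , sp) {fsuc i} {fsuc j} eq =
    cong fsuc (vertexAt-injective p sp eq)

  to-dirPath : ∀ {u v} (p : Star E u v) → Simple p → DirPath E u v (length p)
  to-dirPath p sp =
    vertexAt p , vertexAt-injective p sp , vertexAt-first p , vertexAt-last p , vertexAt-step p

  walk : ∀ L (w : Fin (suc L) → Fin k) → (∀ i → E (w (inject₁ i)) (w (fsuc i))) →
         Star E (w fzero) (w (fromℕ L))
  walk zero w steps = ε
  walk (suc L) w steps = steps fzero ◅ walk L (w ∘ fsuc) (steps ∘ fsuc)

  length-walk : ∀ L w steps → length (walk L w steps) ≡ L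
  length-walk zero w steps = refl
  length-walk (suc L) w steps = cong suc (length-walk L (w ∘ fsuc) (steps ∘ fsuc))

  ∈-walk : ∀ {x} L w steps → x ∈ vertices (walk L w steps) → ∃ λ i → w i ≡ x
  ∈-walk zero w steps (here refl) = fzero , refl
  ∈-walk (suc L) w steps (here refl) = fzero , refl
  ∈-walk (suc L) w steps (there x∈) with ∈-walk L (w ∘ fsuc) (steps ∘ fsuc) x∈
  ... | i , wi≡x = fsuc i , wi≡x

  simple-walk : ∀ L w steps → Injective _≡_ _≡_ w → Simple (walk L w steps)
  simple-walk zero w steps w-inj = tt
  simple-walk (suc L) w steps w-inj =
    (λ w₀∈ → let (i , wi≡w₀) = ∈-walk L (w ∘ fsuc) (steps ∘ fsuc) w₀∈ in suc≢zero (w-inj wi≡w₀))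
    , simple-walk L (w ∘ fsuc) (steps ∘ fsuc) (fsuc-injective ∘ w-inj)
    where
    suc≢zero : ∀ {n} {i : Fin n} → fsuc i ≢ fzero
    suc≢zero ()

  from-dirPath : ∀ {u v L} → DirPath E u v L → Σ (Star E u v) λ p → Simple p × length p ≡ L
  from-dirPath {L = L} (w , w-inj , refl , refl , steps) =
    walk L w steps , simple-walk L w steps w-inj , length-walk L w steps

  closing-cycle : ∀ {x y} (p : Star E x y) → Simple p → 2 ≤ length p → E y x → HasCycle E
  closing-cycle p sp 2≤len yx = length p , 2≤len , vertexAt p , vertexAt-injective p sp , adjacent
    where
    adjacent : ∀ i → E (vertexAt p i) (vertexAt p (nextFin i))
    adjacent i with nextFin-cases i
    ... | inj₁ (refl , next≡0) =
      subst₂ E (sym (vertexAt-last p)) (sym (trans (cong (vertexAt p) next≡0) (vertexAt-first p))) yx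
    ... | inj₂ (j , refl , next≡) = subst (E _) (cong (vertexAt p) (sym next≡)) (vertexAt-step p j)

  open import Data.List.Membership.DecPropositional (_≟_ {k}) using (_∈?_)

  record Meets {a v} (p : Star E a v) (ys : List (Fin k)) : Set where
    constructor meets
    field
      point    : Fin k
      before   : Star E a point
      after    : Star E point v
      splits   : before ◅◅ after ≡ p
      point∈ys : point ∈ ys
      first    : ∀ {x} → x ∈ vertices before → x ∈ ys → x ≡ point

  first-meet : ∀ {a v} (p : Star E a v) {ys} → v ∈ ys → Meets p ys
  first-meet {a} p {ys} v∈ with a ∈? ys
  ... | yes a∈ = meets a ε p refl a∈ λ { (here refl) _ → refl }
  first-meet ε v∈ | no a∉ = ⊥-elim (a∉ v∈)
  first-meet (e ◅ p) v∈ | no a∉ with first-meet p v∈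
  ... | meets c before after refl c∈ first =
    meets c (e ◅ before) after refl c∈ λ { (here refl) x∈ → ⊥-elim (a∉ x∈) ; (there x∈) → first x∈ }

module _ {k : ℕ} {T U : Rel k} where

  vertices-map : ∀ {u v} (f : ∀ {i j} → T i j → U i j) (p : Star T u v) →
                 vertices (map f p) ≡ vertices p
  vertices-map f ε = refl
  vertices-map f (_ ◅ p) = cong (_ ∷_) (vertices-map f p)

  simple-map : ∀ {u v} (f : ∀ {i j} → T i j → U i j) (p : Star T u v) →
               Simple p → Simple (map f p)
  simple-map f ε _ = tt
  simple-map f (_ ◅ p) (u∉p , sp) =
    (λ u∈ → u∉p (subst (_ ∈_) (vertices-map f p) u∈)) , simple-map f p sp

  module _ (rev : Sym T U) where

    ∈-revApp : ∀ {i j l x} (p : Star T j i) (q : Star U j l) →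
               x ∈ vertices (revApp rev p q) → x ∈ vertices p ⊎ x ∈ vertices q
    ∈-revApp ε q x∈ = inj₂ x∈
    ∈-revApp (_ ◅ p) q x∈ with ∈-revApp p (rev _ ◅ q) x∈
    ... | inj₁ x∈p = inj₁ (there x∈p)
    ... | inj₂ (here refl) = inj₁ (there (head∈ p))
    ... | inj₂ (there x∈q) = inj₂ x∈q

    simple-revApp : ∀ {i j l} (p : Star T j i) (q : Star U j l) → Simple p → Simple q →
                    (∀ {x} → x ∈ vertices p → x ∈ vertices q → x ≡ j) →
                    Simple (revApp rev p q)
    simple-revApp ε q _ sq _ = sq
    simple-revApp {j = j} (_◅_ {j = w} e p) q (j∉p , sp) sq common =
      simple-revApp p (rev e ◅ q) sp (w∉q , sq) common′
      where
      back-at-j : ∀ {x} → x ∈ vertices p → x ∈ vertices q → ⊥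
      back-at-j x∈p x∈q = j∉p (subst (_∈ vertices p) (common (there x∈p) x∈q) x∈p)
      w∉q : w ∉ vertices q
      w∉q = back-at-j (head∈ p)
      common′ : ∀ {x} → x ∈ vertices p → x ∈ vertices (rev e ◅ q) → x ≡ w
      common′ _ (here x≡w) = x≡w
      common′ x∈p (there x∈q) = ⊥-elim (back-at-j x∈p x∈q)

    revApp-last-edge : ∀ {i j w l} (e : T j w) (p : Star T w i) (q : Star U j l) →
      ∃₂ λ c (t : T c i) → ∃ λ r → revApp rev (e ◅ p) q ≡ rev t ◅ r
    revApp-last-edge e ε q = _ , e , q , refl
    revApp-last-edge e (e′ ◅ p) q = revApp-last-edge e′ p (rev e ◅ q)

    ∈-reverse : ∀ {i j x} (p : Star T j i) → x ∈ vertices (reverse rev p) → x ∈ vertices p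
    ∈-reverse p x∈ = [ id , (λ { (here refl) → head∈ p }) ]′ (∈-revApp p ε x∈)

    simple-reverse : ∀ {i j} (p : Star T j i) → Simple p → Simple (reverse rev p)
    simple-reverse p sp = simple-revApp p ε sp tt λ { _ (here x≡j) → x≡j }

module _ {k : ℕ} {E : Rel k} (E-sym : Sym E E) (acyclic : ¬ HasCycle E) where

  -- The cycle is u → a ⇝ c ⇝ b → u, where c is the first vertex of p lying on q.
  branching-cycle : ∀ {u a b v} → E u a → E u b → a ≢ b →
    (p : Star E a v) (q : Star E b v) → u ∉ vertices p → u ∉ vertices q →
    Simple p → Simple q → HasCycle E
  branching-cycle {u} {a} {b} ua ub a≢b p q u∉p u∉q sp sq with first-meet p (last∈ q)
  ... | meets c before after refl c∈q first with split q c∈q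
  ...   | q₁ , q₂ , refl =
    closing-cycle (ua ◅ mid) (u∉mid , simple-mid) (s≤s (positive-length mid a≢b)) (E-sym ub)
    where
    mid : Star E a b
    mid = before ◅◅ reverse E-sym q₁
    u∉mid : u ∉ vertices mid
    u∉mid = [ u∉p ∘ ∈-◅◅⁺ˡ before after , u∉q ∘ ∈-◅◅⁺ˡ q₁ q₂ ∘ ∈-reverse E-sym q₁ ]′
          ∘ ∈-◅◅⁻ before (reverse E-sym q₁)
    simple-mid : Simple mid
    simple-mid = simple-◅◅ before (reverse E-sym q₁)
      (proj₁ (simple-◅◅⁻ before after sp))
      (simple-reverse E-sym q₁ (proj₁ (simple-◅◅⁻ q₁ q₂ sq)))
      (λ x∈before x∈rev → first x∈before (∈-◅◅⁺ˡ q₁ q₂ (∈-reverse E-sym q₁ x∈rev)))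

  simple-paths-unique : ∀ {u v} (p q : Star E u v) → Simple p → Simple q →
                        vertices p ≡ vertices q
  simple-paths-unique ε ε _ _ = refl
  simple-paths-unique ε (_ ◅ q) _ (u∉q , _) = ⊥-elim (u∉q (last∈ q))
  simple-paths-unique (_ ◅ p) ε (u∉p , _) _ = ⊥-elim (u∉p (last∈ p))
  simple-paths-unique (_◅_ {j = a} ua p) (_◅_ {j = b} ub q) (u∉p , sp) (u∉q , sq) with a ≟ b
  ... | yes refl = cong (_ ∷_) (simple-paths-unique p q sp sq)
  ... | no a≢b = ⊥-elim (acyclic (branching-cycle ua ub a≢b p q u∉p u∉q sp sq))

module _ {V : Set} (_≺_ : V → V → Set) where

  Comparable : V → V → Set
  Comparable x y = x ≺ y ⊎ y ≺ x

  Incomparable : V → V → Set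
  Incomparable x y = x ≢ y × ¬ Comparable x y

module TreeOrder {V : Set} (_≺_ : V → V → Set)
  (≺-trans : ∀ {x y z} → x ≺ y → y ≺ z → x ≺ z)
  (≺-asym : ∀ {x y} → x ≺ y → ¬ y ≺ x)
  (≺-diamond : ∀ {w x y z} → w ≺ x → w ≺ y → x ≺ z → y ≺ z → ¬ Incomparable _≺_ x y)
  where

  private
    Cmp = Comparable _≺_
    _∥_ = Incomparable _≺_

  ∥-sym : ∀ {x y} → x ∥ y → y ∥ x
  ∥-sym (x≢y , x∦y) = x≢y ∘ sym , x∦y ∘ swap

  common-side : ∀ {x y c} → ¬ Cmp x y → Cmp x c → Cmp y c →
                (x ≺ c × y ≺ c) ⊎ (c ≺ x × c ≺ y)
  common-side x∦y (inj₁ xc) (inj₁ yc) = inj₁ (xc , yc)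
  common-side x∦y (inj₂ cx) (inj₂ cy) = inj₂ (cx , cy)
  common-side x∦y (inj₁ xc) (inj₂ cy) = ⊥-elim (x∦y (inj₁ (≺-trans xc cy)))
  common-side x∦y (inj₂ cx) (inj₁ yc) = ⊥-elim (x∦y (inj₂ (≺-trans yc cx)))

  above-forced : ∀ {x y c d} → x ∥ y → x ≺ d → y ≺ d → Cmp x c → Cmp y c → x ≺ c × y ≺ c
  above-forced x∥y xd yd xc yc with common-side (proj₂ x∥y) xc yc
  ... | inj₁ above = above
  ... | inj₂ (cx , cy) = ⊥-elim (≺-diamond cx cy xd yd x∥y)

  below-forced : ∀ {x y c d} → x ∥ y → d ≺ x → d ≺ y → Cmp x c → Cmp y c → c ≺ x × c ≺ y
  below-forced x∥y dx dy xc yc with common-side (proj₂ x∥y) xc yc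
  ... | inj₂ below = below
  ... | inj₁ (xc′ , yc′) = ⊥-elim (≺-diamond dx dy xc′ yc′ x∥y)

  ≺-beside-below : ∀ {a b c} → a ≺ b → ¬ Cmp b c → Cmp a c → a ≺ c
  ≺-beside-below ab b∦c (inj₁ ac) = ac
  ≺-beside-below ab b∦c (inj₂ ca) = ⊥-elim (b∦c (inj₂ (≺-trans ca ab)))

  ≺-beside-above : ∀ {a b c} → a ≺ b → ¬ Cmp a c → Cmp c b → c ≺ b
  ≺-beside-above ab a∦c (inj₁ cb) = cb
  ≺-beside-above ab a∦c (inj₂ bc) = ⊥-elim (a∦c (inj₁ (≺-trans ab bc)))

  private
    gem-free⁺ : ∀ {x₁ x₂ x₃ x₄ y} → x₁ ∥ x₂ → ¬ Cmp x₂ x₃ → x₃ ∥ x₄ →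
                x₁ ≺ x₃ → x₁ ≺ x₄ → x₂ ≺ x₄ →
                Cmp x₁ y → Cmp x₂ y → Cmp x₃ y → Cmp x₄ y → ⊥
    gem-free⁺ {x₂ = x₂} {x₃} {x₄} {y} x₁∥x₂ x₂∦x₃ x₃∥x₄ x₁x₃ x₁x₄ x₂x₄ c₁ c₂ c₃ c₄ =
      ≺-diamond x₁x₃ x₁x₄ x₃y x₄y x₃∥x₄
      where
      x₂y : x₂ ≺ y
      x₂y = proj₂ (above-forced x₁∥x₂ x₁x₄ x₂x₄ c₁ c₂)
      x₃y : x₃ ≺ y
      x₃y = ≺-beside-above x₂y x₂∦x₃ c₃
      x₄y : x₄ ≺ y
      x₄y = ≺-beside-above x₃y (proj₂ x₃∥x₄) c₄

  -- x₃ x₁ x₄ x₂ is an induced path of the comparability graph and y is adjacent to all of it.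
  gem-free : ∀ {x₁ x₂ x₃ x₄ y} → x₁ ∥ x₂ → ¬ Cmp x₂ x₃ → x₃ ∥ x₄ →
             Cmp x₁ x₃ → Cmp x₁ x₄ → Cmp x₂ x₄ →
             Cmp x₁ y → Cmp x₂ y → Cmp x₃ y → Cmp x₄ y → ⊥
  gem-free {x₁} {x₄ = x₄} x₁∥x₂ x₂∦x₃ x₃∥x₄ (inj₁ x₁x₃) c₁₄ c₂₄ c₁ c₂ c₃ c₄ =
    gem-free⁺ x₁∥x₂ x₂∦x₃ x₃∥x₄ x₁x₃ x₁x₄ (≺-beside-above x₁x₄ (proj₂ x₁∥x₂) c₂₄) c₁ c₂ c₃ c₄
    where
    x₁x₄ : x₁ ≺ x₄
    x₁x₄ = ≺-beside-below x₁x₃ (proj₂ x₃∥x₄) c₁₄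
  gem-free {x₁} {x₂} {x₄ = x₄} x₁∥x₂ x₂∦x₃ x₃∥x₄ (inj₂ x₃x₁) c₁₄ c₂₄ c₁ c₂ c₃ c₄ =
    gem-free⁺ (∥-sym x₃∥x₄) (x₂∦x₃ ∘ swap) (∥-sym x₁∥x₂)
      x₄x₂ x₄x₁ x₃x₁ c₄ c₃ c₂ c₁
    where
    x₄x₁ : x₄ ≺ x₁
    x₄x₁ = ≺-beside-above x₃x₁ (proj₂ x₃∥x₄) (swap c₁₄)
    x₄x₂ : x₄ ≺ x₂
    x₄x₂ = ≺-beside-below x₄x₁ (proj₂ x₁∥x₂) (swap c₂₄)

  octahedron-free : ∀ {x x′ y y′ z z′} → x ∥ x′ → y ∥ y′ → z ∥ z′ →
    Cmp x y → Cmp x y′ → Cmp x′ y → Cmp x′ y′ →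
    Cmp x z → Cmp x z′ → Cmp x′ z → Cmp x′ z′ →
    Cmp y z → Cmp y z′ → Cmp y′ z → Cmp y′ z′ → ⊥
  octahedron-free {x} {x′} {y} {y′} {z} {z′} x∥x′ y∥y′ z∥z′ cxy cxy′ cx′y cx′y′ cxz cxz′ cx′z cx′z′ cyz cyz′ cy′z cy′z′
    with common-side (proj₂ x∥x′) cxy cx′y
  ... | inj₁ (xy , x′y) = ≺-diamond xz xz′ zy z′y z∥z′
    where
    xy′ : x ≺ y′
    xy′ = proj₁ (above-forced x∥x′ xy x′y cxy′ cx′y′)
    xz : x ≺ z
    xz = proj₁ (above-forced x∥x′ xy x′y cxz cx′z)
    xz′ : x ≺ z′
    xz′ = proj₁ (above-forced x∥x′ xy x′y cxz′ cx′z′)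
    zy : z ≺ y
    zy = proj₁ (below-forced y∥y′ xy xy′ cyz cy′z)
    z′y : z′ ≺ y
    z′y = proj₁ (below-forced y∥y′ xy xy′ cyz′ cy′z′)
  ... | inj₂ (yx , yx′) = ≺-diamond yz yz′ zx z′x z∥z′
    where
    y′x : y′ ≺ x
    y′x = proj₁ (below-forced x∥x′ yx yx′ cxy′ cx′y′)
    zx : z ≺ x
    zx = proj₁ (below-forced x∥x′ yx yx′ cxz cx′z)
    z′x : z′ ≺ x
    z′x = proj₁ (below-forced x∥x′ yx yx′ cxz′ cx′z′)
    yz : y ≺ z
    yz = proj₁ (above-forced y∥y′ yx y′x cyz cy′z)
    yz′ : y ≺ z′
    yz′ = proj₁ (above-forced y∥y′ yx y′x cyz′ cy′z′)

  module _ (n : ℕ) (7≤n : 7 ≤ n) (v : ℕ → V)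
    (periodic : ∀ i → v (n + i) ≡ v i)
    (distinct : ∀ i → v i ≢ v (suc i))
    (far : ∀ i j → 2 ≤ j → 2 + j ≤ n → Cmp (v i) (v (j + i)))
    (isolated : ∀ i → Cmp (v i) (v (1 + i)) → ¬ Cmp (v (1 + i)) (v (2 + i)))
    where

    Linked : ℕ → Set
    Linked i = Cmp (v i) (v (1 + i))

    unlinked : ∀ {i} → ¬ Linked i → v i ∥ v (1 + i)
    unlinked {i} ¬l = distinct i , ¬l

    comparable₂ : ∀ i → Cmp (v i) (v (2 + i))
    comparable₂ i = far i 2 ≤-refl (≤-trans (m≤m+n 4 3) 7≤n)

    comparable₃ : ∀ i → Cmp (v i) (v (3 + i))
    comparable₃ i = far i 3 (m≤m+n 2 1) (≤-trans (m≤m+n 5 2) 7≤n)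

    comparable₄ : ∀ i → Cmp (v i) (v (4 + i))
    comparable₄ i = far i 4 (m≤m+n 2 2) (≤-trans (m≤m+n 6 1) 7≤n)

    comparable₅ : ∀ i → Cmp (v i) (v (5 + i))
    comparable₅ i = far i 5 (m≤m+n 2 3) 7≤n

    no-unlinked-triple : ∀ i → ¬ Linked i → ¬ Linked (1 + i) → ¬ Linked (2 + i) → ⊥
    no-unlinked-triple i ¬l₀ ¬l₁ ¬l₂ =
      gem-free (unlinked ¬l₀) ¬l₁ (unlinked ¬l₂)
        (comparable₂ i) (comparable₃ i) (comparable₂ (1 + i))
        (comparable₅ i) (comparable₄ (1 + i)) (comparable₃ (2 + i)) (comparable₂ (3 + i))

    no-alternation : ∀ i → ¬ Linked i → Linked (1 + i) → ¬ Linked (2 + i) → Linked (3 + i) →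
                     ¬ Linked (4 + i) → ⊥
    no-alternation i ¬l₀ l₁ ¬l₂ l₃ ¬l₄ =
      octahedron-free (unlinked ¬l₀) (unlinked ¬l₂) (unlinked ¬l₄)
        (comparable₂ i) (comparable₃ i) l₁ (comparable₂ (1 + i))
        (comparable₄ i) (comparable₅ i) (comparable₃ (1 + i)) (comparable₄ (1 + i))
        (comparable₂ (2 + i)) (comparable₃ (2 + i)) l₃ (comparable₂ (3 + i))

    incomparable₆ : ∀ i → ¬ Linked i → Linked (1 + i) → ¬ Linked (2 + i) → ¬ Linked (5 + i) →
                    ¬ Cmp (v i) (v (6 + i))
    incomparable₆ i ¬l₀ l₁ ¬l₂ ¬l₅ c₀₆ =
      octahedron-free (unlinked ¬l₀) (unlinked ¬l₂) (unlinked ¬l₅)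
        (comparable₂ i) (comparable₃ i) l₁ (comparable₂ (1 + i))
        (comparable₅ i) c₀₆ (comparable₄ (1 + i)) (comparable₅ (1 + i))
        (comparable₃ (2 + i)) (comparable₄ (2 + i)) (comparable₂ (3 + i)) (comparable₃ (3 + i))

    -- For n = 7 the vertex 6 + i is the predecessor of i.
    ¬¬comparable₆ : ∀ i → ¬ Linked i → ¬ Linked (5 + i) → ¬ ¬ Cmp (v i) (v (6 + i))
    ¬¬comparable₆ i ¬l₀ ¬l₅ ¬c₀₆ with m≤n⇒m<n∨m≡n 7≤n
    ... | inj₁ 8≤n = ¬c₀₆ (far i 6 (m≤m+n 2 4) 8≤n)
    ... | inj₂ 7≡n = ¬¬-excluded-middle λ
      { (yes l₆) → ¬c₀₆ (swap (subst (Cmp (v (6 + i))) (v₇ i) l₆))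
      ; (no ¬l₆) → no-unlinked-triple (5 + i) ¬l₅ ¬l₆ (¬l₀ ∘ subst₂ Cmp (v₇ i) (v₇ (1 + i)))
      }
      where
      v₇ : ∀ j → v (7 + j) ≡ v j
      v₇ j = subst (λ p → v (p + j) ≡ v j) (sym 7≡n) (periodic j)

    linked-periodic : ∀ i → Linked i → Linked (n + i)
    linked-periodic i = subst₂ Cmp (sym (periodic i))
      (sym (trans (cong v (sym (+-suc n i))) (periodic (suc i))))

    rise : ∀ j → Linked j → ∃ λ i → ¬ Linked i × Linked (1 + i)
    rise j l = pred n + j , (λ l₀ → isolated _ l₀ l′) , l′
      where
      l′ : Linked (1 + (pred n + j))
      l′ = subst (λ p → Linked (p + j)) (sym (suc-pred n {{>-nonZero (≤-trans (s≤s z≤n) 7≤n)}}))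
             (linked-periodic j l)

    after-rise : ∀ i → ¬ Linked i → Linked (1 + i) → ⊥
    after-rise i ¬l₀ l₁ = ¬¬-excluded-middle λ
      { (yes l₃) → no-alternation i ¬l₀ l₁ ¬l₂ l₃ (isolated (3 + i) l₃)
      ; (no ¬l₃) → ¬¬-excluded-middle λ
        { (no ¬l₄) → no-unlinked-triple (2 + i) ¬l₂ ¬l₃ ¬l₄
        ; (yes l₄) → let ¬l₅ = isolated (4 + i) l₄ in
            ¬¬comparable₆ i ¬l₀ ¬l₅ (incomparable₆ i ¬l₀ l₁ ¬l₂ ¬l₅)
        }
      }
      where
      ¬l₂ : ¬ Linked (2 + i)
      ¬l₂ = isolated (1 + i) l₁

    no-cyclic-sequence : ⊥
    no-cyclic-sequence = ¬¬-excluded-middle {A = ∃ Linked} λ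
      { (yes (j , l)) → let (i , ¬l₀ , l₁) = rise j l in after-rise i ¬l₀ l₁
      ; (no none) → no-unlinked-triple 0 (none ∘ (0 ,_)) (none ∘ (1 ,_)) (none ∘ (2 ,_))
      }

OneIsSumOfOthers : ℕ → ℕ → ℕ → Set
OneIsSumOfOthers a b c = c ≡ a + b ⊎ a ≡ b + c ⊎ b ≡ c + a

∣-one-is-sum : ∀ {m a b c} → m ∣ a → m ∣ b → OneIsSumOfOthers a b c → m ∣ c
∣-one-is-sum {m} m∣a m∣b (inj₁ c≡a+b) = subst (m ∣_) (sym c≡a+b) (∣m∣n⇒∣m+n m∣a m∣b)
∣-one-is-sum {m} m∣a m∣b (inj₂ (inj₁ a≡b+c)) = ∣m+n∣m⇒∣n (subst (m ∣_) a≡b+c m∣a) m∣b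
∣-one-is-sum {m} {a} {c = c} m∣a m∣b (inj₂ (inj₂ b≡c+a)) =
  ∣m+n∣m⇒∣n (subst (m ∣_) (trans b≡c+a (+-comm c a)) m∣b) m∣a

module OrientedTree {k : ℕ} {A : Rel k}
  (antisym : (u v : Fin k) → A u v → ¬ A v u) (acyclic : ¬ HasCycle (Und A)) where

  Und-sym : Sym (Und A) (Und A)
  Und-sym = swap

  directed-unique : ∀ {u v} (p q : Star A u v) → Simple p → Simple q → vertices p ≡ vertices q
  directed-unique p q sp sq = begin
    vertices p            ≡⟨ sym (vertices-map inj₁ p) ⟩
    vertices (map inj₁ p) ≡⟨ simple-paths-unique Und-sym acyclic (map inj₁ p) (map inj₁ q)
                               (simple-map inj₁ p sp) (simple-map inj₁ q sq) ⟩
    vertices (map inj₁ q) ≡⟨ vertices-map inj₁ q ⟩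
    vertices q            ∎
    where open ≡-Reasoning

  length-unique : ∀ {u v} (p q : Star A u v) → Simple p → Simple q → length p ≡ length q
  length-unique p q sp sq = suc-injective (begin
    suc (length p)            ≡⟨ sym (length-vertices p) ⟩
    List.length (vertices p)  ≡⟨ cong List.length (directed-unique p q sp sq) ⟩
    List.length (vertices q)  ≡⟨ length-vertices q ⟩
    suc (length q)            ∎)
    where open ≡-Reasoning

  -- Read backwards, q is an undirected path from x to y; it has the same vertices as p,
  -- so its first edge a → x reverses the first edge x → a of p.
  no-antiparallel : ∀ {x y} (p : Star A x y) (q : Star A y x) → Simple p → Simple q → x ≢ y → ⊥
  no-antiparallel ε _ _ _ x≢x = x≢x refl
  no-antiparallel _ ε _ _ y≢y = y≢y refl
  no-antiparallel {x} (_◅_ {j = a} xa p) (ya ◅ q) sp sq _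
    with revApp-last-edge inj₂ ya q ε
  ... | c , cx , r , rev≡ = antisym x a xa (subst (λ z → A z x) (sym a≡c) cx)
    where
    same : vertices (map inj₁ (xa ◅ p)) ≡ vertices (reverse inj₂ (ya ◅ q))
    same = simple-paths-unique Und-sym acyclic (map inj₁ (xa ◅ p)) (reverse inj₂ (ya ◅ q))
             (simple-map inj₁ (xa ◅ p) sp) (simple-reverse inj₂ (ya ◅ q) sq)
    a≡c : a ≡ c
    a≡c with vertices-∷ (map inj₁ p) | vertices-∷ r
    ... | xs , p≡ | ys , r≡ =
      ∷-injectiveˡ (trans (sym p≡) (trans (∷-injectiveʳ (trans same (cong vertices rev≡))) r≡))

  meet-only-at-junction : ∀ {x y z w} (p : Star A x y) (q : Star A y z) → Simple p → Simple q →
                          w ∈ vertices p → w ∈ vertices q → w ≡ y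
  meet-only-at-junction {y = y} {w = w} p q sp sq w∈p w∈q with w ≟ y
  ... | yes w≡y = w≡y
  ... | no w≢y =
    ⊥-elim (no-antiparallel (proj₁ wy) (proj₁ yw) (proj₂ wy) (proj₂ yw) w≢y)
    where
    wy : SimplePath {E = A} w y
    wy = proj₂ (simple-split p sp w∈p)
    yw : SimplePath {E = A} y w
    yw = proj₁ (simple-split q sq w∈q)

  ◅◅-simple : ∀ {x y z} (p : Star A x y) (q : Star A y z) → Simple p → Simple q → Simple (p ◅◅ q)
  ◅◅-simple p q sp sq = simple-◅◅ p q sp sq (meet-only-at-junction p q sp sq)

  _≺_ : Fin k → Fin k → Set
  x ≺ y = x ≢ y × SimplePath {E = A} x y

  ≺-trans : ∀ {x y z} → x ≺ y → y ≺ z → x ≺ z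
  ≺-trans (x≢y , p , sp) (_ , q , sq) =
    (λ { refl → no-antiparallel p q sp sq x≢y }) , p ◅◅ q , ◅◅-simple p q sp sq

  ≺-asym : ∀ {x y} → x ≺ y → ¬ y ≺ x
  ≺-asym (x≢y , p , sp) (_ , q , sq) = no-antiparallel p q sp sq x≢y

  ≺-diamond : ∀ {w x y z} → w ≺ x → w ≺ y → x ≺ z → y ≺ z → ¬ Incomparable _≺_ x y
  ≺-diamond {y = y} (_ , p₁ , s₁) (_ , q₁ , t₁) (_ , p₂ , s₂) (_ , q₂ , t₂) (x≢y , x∦y) =
    [ (λ y∈p₁ → x∦y (inj₂ (x≢y ∘ sym , proj₂ (simple-split p₁ s₁ y∈p₁))))
    , (λ y∈p₂ → x∦y (inj₁ (x≢y , proj₁ (simple-split p₂ s₂ y∈p₂)))) ]′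
      (∈-◅◅⁻ p₁ p₂ y∈p₁◅◅p₂)
    where
    y∈p₁◅◅p₂ : y ∈ vertices (p₁ ◅◅ p₂)
    y∈p₁◅◅p₂ = subst (y ∈_)
      (directed-unique (q₁ ◅◅ q₂) (p₁ ◅◅ p₂) (◅◅-simple q₁ q₂ t₁ t₂) (◅◅-simple p₁ p₂ s₁ s₂))
      (∈-◅◅⁺ˡ q₁ q₂ (last∈ q₁))

  length≺ : ∀ {x y} → x ≺ y → ℕ
  length≺ (_ , p , _) = length p

  length≺-additive : ∀ {x y z} (xy : x ≺ y) (yz : y ≺ z) (xz : x ≺ z) →
                     length≺ xz ≡ length≺ xy + length≺ yz
  length≺-additive (_ , p , sp) (_ , q , sq) (_ , r , sr) =
    trans (length-unique r (p ◅◅ q) sr (◅◅-simple p q sp sq)) (length-◅◅ p q)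

  distance : ∀ {x y} → Comparable _≺_ x y → ℕ
  distance (inj₁ xy) = length≺ xy
  distance (inj₂ yx) = length≺ yx

  distances-additive : ∀ {x y z} (c₁ : Comparable _≺_ x y) (c₂ : Comparable _≺_ y z)
    (c₃ : Comparable _≺_ x z) → OneIsSumOfOthers (distance c₁) (distance c₂) (distance c₃)
  distances-additive (inj₁ xy) (inj₁ yz) (inj₁ xz) = inj₁ (length≺-additive xy yz xz)
  distances-additive (inj₁ xy) (inj₁ yz) (inj₂ zx) = ⊥-elim (≺-asym (≺-trans xy yz) zx)
  distances-additive (inj₂ yx) (inj₂ zy) (inj₁ xz) = ⊥-elim (≺-asym (≺-trans zy yx) xz)
  distances-additive (inj₂ yx) (inj₂ zy) (inj₂ zx) =
    inj₁ (trans (length≺-additive zy yx zx) (+-comm (length≺ zy) (length≺ yx)))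
  distances-additive (inj₁ xy) (inj₂ zy) (inj₁ xz) =
    inj₂ (inj₁ (trans (length≺-additive xz zy xy) (+-comm (length≺ xz) (length≺ zy))))
  distances-additive (inj₁ xy) (inj₂ zy) (inj₂ zx) = inj₂ (inj₂ (length≺-additive zx xy zy))
  distances-additive (inj₂ yx) (inj₁ yz) (inj₁ xz) =
    inj₂ (inj₂ (trans (length≺-additive yx xz yz) (+-comm (length≺ yx) (length≺ xz))))
  distances-additive (inj₂ yx) (inj₁ yz) (inj₂ zx) = inj₂ (inj₁ (length≺-additive yz zx yx))

module Willow (m : ℕ) {k : ℕ} {A : Rel k}
  (antisym : (u v : Fin k) → A u v → ¬ A v u) (acyclic : ¬ HasCycle (Und A)) where

  open OrientedTree antisym acyclic

  private
    directed-comparable : ∀ {x y L} → DirPath A x y L → ¬ m ∣ L →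
                          Σ (x ≺ y) λ xy → ¬ m ∣ length≺ xy
    directed-comparable dp m∤L with from-dirPath dp
    ... | p , sp , length≡L =
      ((λ x≡y → m∤L (subst (m ∣_) (trans (sym (simple-loop-length p sp x≡y)) length≡L) (_ ∣0)))
      , p , sp)
      , m∤L ∘ subst (m ∣_) length≡L

  willow-comparable : ∀ {x y} → WillowRel m A x y →
                      Σ (Comparable _≺_ x y) λ c → ¬ m ∣ distance c
  willow-comparable (inj₁ (_ , dp , m∤L)) =
    let (xy , m∤) = directed-comparable dp m∤L in inj₁ xy , m∤
  willow-comparable (inj₂ (_ , dp , m∤L)) =
    let (yx , m∤) = directed-comparable dp m∤L in inj₂ yx , m∤

  non-willow-divides : ∀ {x y} → ¬ WillowRel m A x y → (c : Comparable _≺_ x y) → m ∣ distance c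
  non-willow-divides ¬w (inj₁ (_ , p , sp)) =
    decidable-stable (m ∣? length p) λ m∤ → ¬w (inj₁ (length p , to-dirPath p sp , m∤))
  non-willow-divides ¬w (inj₂ (_ , p , sp)) =
    decidable-stable (m ∣? length p) λ m∤ → ¬w (inj₂ (length p , to-dirPath p sp , m∤))

  non-willow-transitive : ∀ {x y z} → ¬ WillowRel m A x y → ¬ WillowRel m A y z →
    Comparable _≺_ x y → Comparable _≺_ y z → ¬ WillowRel m A x z
  non-willow-transitive ¬w₁ ¬w₂ c₁ c₂ w with willow-comparable w
  ... | c₃ , m∤ = m∤ (∣-one-is-sum (non-willow-divides ¬w₁ c₁) (non-willow-divides ¬w₂ c₂)
                                  (distances-additive c₁ c₂ c₃))

-- CycleAdj N u v unfolds to NatCycleAdj N (toℕ u) (toℕ v).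
NatCycleAdj : ℕ → ℕ → ℕ → Set
NatCycleAdj N a b = (b ≡ suc a) ⊎ (a ≡ suc b) ⊎ ((a ≡ 0 × b ≡ N ∸ 1) ⊎ (b ≡ 0 × a ≡ N ∸ 1))

NatCycleAdj-sym : ∀ {N a b} → NatCycleAdj N a b → NatCycleAdj N b a
NatCycleAdj-sym (inj₁ b≡1+a) = inj₂ (inj₁ b≡1+a)
NatCycleAdj-sym (inj₂ (inj₁ a≡1+b)) = inj₁ a≡1+b
NatCycleAdj-sym (inj₂ (inj₂ (inj₁ ends))) = inj₂ (inj₂ (inj₂ ends))
NatCycleAdj-sym (inj₂ (inj₂ (inj₂ ends))) = inj₂ (inj₂ (inj₁ ends))

labels-apart⁺ : ∀ {N a b j} → 2 ≤ j → 2 + j ≤ N → b ≡ j + a → a ≢ b × ¬ NatCycleAdj N a b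
labels-apart⁺ {N} {a} {b} {j} 2≤j 2+j≤N b≡j+a = <⇒≢ a<b , nonadjacent
  where
  1+a<b : suc a < b
  1+a<b = subst (2 + a ≤_) (sym b≡j+a) (+-monoˡ-≤ a 2≤j)
  a<b : a < b
  a<b = ≤-trans (n≤1+n (suc a)) 1+a<b
  nonadjacent : ¬ NatCycleAdj N a b
  nonadjacent (inj₁ b≡1+a) = <⇒≢ 1+a<b (sym b≡1+a)
  nonadjacent (inj₂ (inj₁ a≡1+b)) = <-asym a<b (≤-reflexive (sym a≡1+b))
  nonadjacent (inj₂ (inj₂ (inj₁ (a≡0 , b≡N∸1)))) =
    <⇒≢ (∸-monoˡ-≤ 1 2+j≤N) (trans (sym (+-identityʳ j))
      (trans (cong (j +_) (sym a≡0)) (trans (sym b≡j+a) b≡N∸1)))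
  nonadjacent (inj₂ (inj₂ (inj₂ (b≡0 , _)))) = <⇒≢ (≤-trans (s≤s z≤n) 1+a<b) (sym b≡0)

labels-apart : ∀ {N a b j} → 2 ≤ j → 2 + j ≤ N → b ≡ j + a ⊎ b + N ≡ j + a →
               a ≢ b × ¬ NatCycleAdj N a b
labels-apart 2≤j 2+j≤N (inj₁ b≡j+a) = labels-apart⁺ 2≤j 2+j≤N b≡j+a
labels-apart {N} {a} {b} {j} 2≤j 2+j≤N (inj₂ b+N≡j+a) =
  let (b≢a , ¬adj) = labels-apart⁺ 2≤N∸j 2+N∸j≤N a≡N∸j+b
  in b≢a ∘ sym , ¬adj ∘ NatCycleAdj-sym {N}
  where
  j≤N : j ≤ N
  j≤N = m+n≤o⇒n≤o 2 2+j≤N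
  2≤N∸j : 2 ≤ N ∸ j
  2≤N∸j = m+n≤o⇒m≤o∸n 2 2+j≤N
  2+N∸j≤N : 2 + (N ∸ j) ≤ N
  2+N∸j≤N = subst (2 + (N ∸ j) ≤_) (m+[n∸m]≡n j≤N) (+-monoˡ-≤ (N ∸ j) 2≤j)
  a≡N∸j+b : a ≡ (N ∸ j) + b
  a≡N∸j+b = +-cancelˡ-≡ j a ((N ∸ j) + b) (begin
    j + a             ≡⟨ sym b+N≡j+a ⟩
    b + N             ≡⟨ +-comm b N ⟩
    N + b             ≡⟨ cong (_+ b) (sym (m+[n∸m]≡n j≤N)) ⟩
    j + (N ∸ j) + b   ≡⟨ +-assoc j (N ∸ j) b ⟩
    j + ((N ∸ j) + b) ∎)
    where open ≡-Reasoning

labels-adjacent : ∀ {N a b} → 2 ≤ N → a < N → b ≡ 1 + a ⊎ b + N ≡ 1 + a →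
                  a ≢ b × NatCycleAdj N a b
labels-adjacent {a = a} _ _ (inj₁ b≡1+a) = (λ a≡b → <⇒≢ (n<1+n a) (trans a≡b b≡1+a)) , inj₁ b≡1+a
labels-adjacent {N} {a} {b} 2≤N a<N (inj₂ b+N≡1+a) = a≢b , inj₂ (inj₂ (inj₂ (b≡0 , a≡N∸1)))
  where
  b≡0 : b ≡ 0
  b≡0 = n≤0⇒n≡0 (+-cancelʳ-≤ N b 0 (subst (_≤ N) (sym b+N≡1+a) a<N))
  a≡N∸1 : a ≡ N ∸ 1
  a≡N∸1 = cong pred (trans (sym b+N≡1+a) (cong (_+ N) b≡0))
  a≢b : a ≢ b
  a≢b a≡b = <⇒≢ (≤-trans (s≤s z≤n) (∸-monoˡ-≤ 1 2≤N)) (trans (sym b≡0) (trans (sym a≡b) a≡N∸1))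

module _ (N : ℕ) .{{_ : NonZero N}} where

  position : ℕ → Fin N
  position i = fromℕ< (m%n<n i N)

  toℕ-position : ∀ i → toℕ (position i) ≡ i % N
  toℕ-position i = toℕ-fromℕ< (m%n<n i N)

  position-periodic : ∀ i → position (N + i) ≡ position i
  position-periodic i = toℕ-injective (begin
    toℕ (position (N + i)) ≡⟨ toℕ-position (N + i) ⟩
    (N + i) % N            ≡⟨ cong (_% N) (+-comm N i) ⟩
    (i + N) % N            ≡⟨ [m+n]%n≡m%n i N ⟩
    i % N                  ≡⟨ sym (toℕ-position i) ⟩
    toℕ (position i)       ∎)
    where open ≡-Reasoning

  [m+n]%N≡[m+n%N]%N : ∀ j i → (j + i) % N ≡ (j + i % N) % N
  [m+n]%N≡[m+n%N]%N j i = begin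
    (j + i) % N               ≡⟨ %-distribˡ-+ j i N ⟩
    (j % N + i % N) % N       ≡⟨ cong (λ r → (j % N + r) % N) (sym (m%n%n≡m%n i N)) ⟩
    (j % N + i % N % N) % N   ≡⟨ sym (%-distribˡ-+ j (i % N) N) ⟩
    (j + i % N) % N           ∎
    where open ≡-Reasoning

  +-%-cases : ∀ j i → j < N → (j + i) % N ≡ j + i % N ⊎ (j + i) % N + N ≡ j + i % N
  +-%-cases j i j<N with j + i % N <? N
  ... | yes s<N = inj₁ (trans ([m+n]%N≡[m+n%N]%N j i) (m<n⇒m%n≡m s<N))
  ... | no s≮N = inj₂ (begin
    (j + i) % N + N           ≡⟨ cong (_+ N) ([m+n]%N≡[m+n%N]%N j i) ⟩
    (j + i % N) % N + N       ≡⟨ cong (_+ N) (sym (m≤n⇒[n∸m]%m≡n%m N≤s)) ⟩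
    (j + i % N ∸ N) % N + N   ≡⟨ cong (_+ N) (m<n⇒m%n≡m s∸N<N) ⟩
    j + i % N ∸ N + N         ≡⟨ m∸n+n≡m N≤s ⟩
    j + i % N                 ∎)
    where
    open ≡-Reasoning
    N≤s : N ≤ j + i % N
    N≤s = ≮⇒≥ s≮N
    s∸N<N : j + i % N ∸ N < N
    s∸N<N = m<n+o⇒m∸n<o (j + i % N) N (+-mono-< j<N (m%n<n i N))

  position-far : ∀ {i j} → 2 ≤ j → 2 + j ≤ N → ComplCycleAdj N (position i) (position (j + i))
  position-far {i} {j} 2≤j 2+j≤N =
    (λ eq → proj₁ apart (trans (sym (toℕ-position i)) (trans (cong toℕ eq) (toℕ-position (j + i)))))
    , proj₂ apart ∘ subst₂ (NatCycleAdj N) (toℕ-position i) (toℕ-position (j + i))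
    where
    apart : i % N ≢ (j + i) % N × ¬ NatCycleAdj N (i % N) ((j + i) % N)
    apart = labels-apart 2≤j 2+j≤N (+-%-cases j i (≤-trans (n≤1+n (suc j)) 2+j≤N))

  position-consecutive : ∀ {i} → 2 ≤ N → position i ≢ position (suc i) ×
                         CycleAdj N (position i) (position (suc i))
  position-consecutive {i} 2≤N =
    (λ eq → proj₁ adjacent (trans (sym (toℕ-position i)) (trans (cong toℕ eq) (toℕ-position (suc i)))))
    , subst₂ (NatCycleAdj N) (sym (toℕ-position i)) (sym (toℕ-position (suc i))) (proj₂ adjacent)
    where
    adjacent : i % N ≢ suc i % N × NatCycleAdj N (i % N) (suc i % N)
    adjacent = labels-adjacent 2≤N (m%n<n i N) (+-%-cases 1 i 2≤N)

proposition9p6 : (n : ℕ) → 7 ≤ n → ¬ IsWillow n (ComplCycleAdj n)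
proposition9p6 zero ()
proposition9p6 n@(suc _) 7≤n (m , _ , k , A , f , (_ , antisym , _ , acyclic) , f-injective , willow) =
  no-cyclic-sequence n 7≤n v (cong f ∘ position-periodic n) distinct comparable isolated
  where
  open OrientedTree antisym acyclic
  open TreeOrder _≺_ ≺-trans ≺-asym ≺-diamond
  open Willow m antisym acyclic
  2≤n : 2 ≤ n
  2≤n = ≤-trans (m≤m+n 2 5) 7≤n
  v : ℕ → Fin k
  v i = f (position n i)
  edge : ∀ i j → 2 ≤ j → 2 + j ≤ n → WillowRel m A (v i) (v (j + i))
  edge i j 2≤j 2+j≤n = let e = position-far n 2≤j 2+j≤n in proj₁ (willow _ _ (proj₁ e)) e
  non-edge : ∀ i → ¬ WillowRel m A (v i) (v (suc i))
  non-edge i w = let (ne , adj) = position-consecutive n 2≤n in proj₂ (proj₂ (willow _ _ ne) w) adj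
  distinct : ∀ i → v i ≢ v (suc i)
  distinct i = proj₁ (position-consecutive n 2≤n) ∘ f-injective
  comparable : ∀ i j → 2 ≤ j → 2 + j ≤ n → Comparable _≺_ (v i) (v (j + i))
  comparable i j 2≤j 2+j≤n = proj₁ (willow-comparable (edge i j 2≤j 2+j≤n))
  isolated : ∀ i → Comparable _≺_ (v i) (v (1 + i)) → ¬ Comparable _≺_ (v (1 + i)) (v (2 + i))
  isolated i c₁ c₂ = non-willow-transitive (non-edge i) (non-edge (suc i)) c₁ c₂
                       (edge i 2 ≤-refl (≤-trans (m≤m+n 4 3) 7≤n))
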